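{- Let $n>1$ be an odd integer and let $Q_n(x_1,\dots,x_n)=(x_1-x_2)(x_2-x_3)\cdots(x_{n-1}-x_n)$. Then $\mathcal L(Q_n)(x)=x^{(n-1)/2}$.
   Context: For a homogeneous polynomial $P(x_1,\dots,x_n)=\sum_{j_1+\cdots+j_n=m}c_{j_1,\dots,j_n}x_1^{j_1}\cdots x_n^{j_n}\in\mathbb C[x_1,\dots,x_n]$ of degree $m$, define the one-variable polynomial $\mathcal L(P)(x)=\sum_{j_1+\cdots+j_n=m}c_{j_1,\dots,j_n}(x)_{j_1}\cdots(x)_{j_n}$, where $(x)_j=x(x-1)\cdots(x-j+1)$ denotes the falling factorial (with $(x)_0=1$). -}

module Defs where

open import Data.Nat as ℕ using (ℕ; zero; suc)
open import Data.Integer as ℤ using (ℤ; +_; _-_; _*_)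
open import Data.Fin using (Fin; inject₁) renaming (zero to fzero; suc to fsuc)
open import Data.Vec using (Vec; replicate; zipWith; toList; updateAt)
open import Data.List using (allFin; List; []; _∷_; map; concatMap; foldr)
open import Data.Product using (_×_; _,_)

-- A polynomial in ℤ[x₁,…,xₙ] (⊆ ℂ[x₁,…,xₙ]) given as a finite formal sum of
-- terms c · x^e, with e : Vec ℕ n the exponent vector (repetitions allowed).
Term : ℕ → Set
Term n = ℤ × Vec ℕ n

Poly : ℕ → Set
Poly n = List (Term n)

_·_ : ∀ {n} → Poly n → Poly n → Poly n
p · q = concatMap (λ { (c , e) → map (λ { (d , f) → (c * d , zipWith ℕ._+_ e f) }) q }) p

one : ∀ {n} → Poly n
one {n} = (+ 1 , replicate n 0) ∷ []

unitExp : ∀ {n} → Fin n → Vec ℕ n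
unitExp {n} i = updateAt (replicate n 0) i (λ _ → 1)

-- the factor (x_{k+1} - x_{k+2}) in n = m+1 variables, k : Fin m
diffFactor : (m : ℕ) → Fin m → Poly (suc m)
diffFactor m k = (+ 1 , unitExp (inject₁ k)) ∷ (ℤ.-[1+ 0 ] , unitExp (fsuc k)) ∷ []

Q : (n : ℕ) → Poly n
Q zero = one
Q (suc m) = foldr _·_ one (map (diffFactor m) (allFin m))

sumℤ : List ℤ → ℤ
sumℤ = foldr ℤ._+_ (+ 0)

productℤ : List ℤ → ℤ
productℤ = foldr _*_ (+ 1)

falling : ℤ → ℕ → ℤ
falling x zero = + 1
falling x (suc j) = falling x j * (x - + j)

-- 𝓛(P)(x) = Σ c_{j₁…jₙ} (x)_{j₁}⋯(x)_{jₙ}, evaluated at x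
-- (𝓛 is linear in the coefficients, so this is independent of how like terms are grouped)
𝓛 : ∀ {n} → Poly n → ℤ → ℤ
𝓛 P x = sumℤ (map (λ { (c , e) → c * productℤ (map (falling x) (toList e)) }) P)

-- Write 𝓛₁ j P for 𝓛 (x₁^j · P). Since Q (m + 2) = (x₁ - x₂) · Q (m + 1)(x₂, …) and 𝓛 is
-- multiplicative over disjoint sets of variables, 𝓛₁ j (Q (m + 2)) = (x)_{j+1} A - (x)_j B
-- with A = 𝓛₁ 0 (Q (m + 1)) and B = 𝓛₁ 1 (Q (m + 1)). Applying this twice, the B-terms cancel
-- and 𝓛₁ 0 (Q (m + 3)) = ((x)₁² - (x)₂) · A = x · A, while 𝓛₁ 0 (Q 1) = 1.
module Submission where

open import Defs
open import Data.Nat using (ℕ; _<_; _∸_; _%_; _/_)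
open import Data.Integer using (ℤ; _^_)
open import Relation.Binary.PropositionalEquality using (_≡_)

open import Data.Nat as ℕ using (zero; suc)
import Data.Nat.Properties as ℕ
open import Data.Nat.DivMod using (m≡m%n+[m/n]*n; m*n/n≡m)
open import Data.Integer as ℤ using (+_; -[1+_]; _+_; _-_; _*_)
import Data.Integer.Properties as ℤ
open import Data.Integer.Tactic.RingSolver using (solve-∀)
open import Data.Fin using () renaming (zero to fzero; suc to fsuc)
open import Data.Vec using (Vec; []; _∷_; zipWith; replicate; toList)
open import Data.Vec.Properties using (zipWith-identityˡ)
open import Data.List using (List; []; _∷_; _++_; map; foldr; tabulate; allFin)
open import Data.List.Properties using (map-++; map-tabulate; concatMap-++)
open import Data.Product using (_,_)
open import Relation.Binary.PropositionalEquality using (refl; sym; trans; cong; cong₂; subst; module ≡-Reasoning)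
open ≡-Reasoning

shift : ∀ {n} → Poly n → Poly (suc n)
shift [] = []
shift ((c , e) ∷ P) = (c , 0 ∷ e) ∷ shift P

shift-++ : ∀ {n} (P R : Poly n) → shift (P ++ R) ≡ shift P ++ shift R
shift-++ [] R = refl
shift-++ (t ∷ P) R = cong (_ ∷_) (shift-++ P R)

shift-· : ∀ {n} (P R : Poly n) → shift (P · R) ≡ shift P · shift R
shift-· [] R = refl
shift-· ((c , e) ∷ P) R = trans (shift-++ _ (P · R)) (cong₂ _++_ (shift-scale R) (shift-· P R))
  where
  shift-scale : ∀ R → shift (map _ R) ≡ map _ (shift R)
  shift-scale [] = refl
  shift-scale ((d , f) ∷ R) = cong (_ ∷_) (shift-scale R)

shift-foldr-· : ∀ {n} (Ps : List (Poly n)) → shift (foldr _·_ one Ps) ≡ foldr _·_ one (map shift Ps)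
shift-foldr-· [] = refl
shift-foldr-· (P ∷ Ps) = trans (shift-· P _) (cong (shift P ·_) (shift-foldr-· Ps))

·-distribʳ-++ : ∀ {n} (P R S : Poly n) → (P ++ R) · S ≡ P · S ++ R · S
·-distribʳ-++ P R S = concatMap-++ _ P R

Q-suc-suc : ∀ m → Q (suc (suc m)) ≡ diffFactor (suc m) fzero · shift (Q (suc m))
Q-suc-suc m = cong (diffFactor (suc m) fzero ·_) (begin
  foldr _·_ one (map (diffFactor (suc m)) (tabulate fsuc))
    ≡⟨ cong (foldr _·_ one) shifted-factors ⟩
  foldr _·_ one (map shift (map (diffFactor m) (allFin m)))
    ≡⟨ sym (shift-foldr-· (map (diffFactor m) (allFin m))) ⟩
  shift (Q (suc m)) ∎)
  where
  shifted-factors : map (diffFactor (suc m)) (tabulate fsuc) ≡ map shift (map (diffFactor m) (allFin m))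
  shifted-factors = begin
    map (diffFactor (suc m)) (tabulate fsuc)  ≡⟨ map-tabulate fsuc (diffFactor (suc m)) ⟩
    tabulate (λ k → shift (diffFactor m k))   ≡⟨ sym (map-tabulate (diffFactor m) shift) ⟩
    map shift (tabulate (diffFactor m))       ≡⟨ cong (map shift) (sym (map-tabulate (λ k → k) (diffFactor m))) ⟩
    map shift (map (diffFactor m) (allFin m)) ∎

sumℤ-++ : (as bs : List ℤ) → sumℤ (as ++ bs) ≡ sumℤ as + sumℤ bs
sumℤ-++ [] bs = sym (ℤ.+-identityˡ (sumℤ bs))
sumℤ-++ (a ∷ as) bs = trans (cong (λ s → a + s) (sumℤ-++ as bs)) (sym (ℤ.+-assoc a (sumℤ as) (sumℤ bs)))

module _ (x : ℤ) where

  falling∏ : ∀ {m} → Vec ℕ m → ℤ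
  falling∏ es = productℤ (map (falling x) (toList es))

  𝓛₁-term : ∀ {m} → ℕ → Term (suc m) → ℤ
  𝓛₁-term j (c , e₁ ∷ es) = c * (falling x (j ℕ.+ e₁) * falling∏ es)

  𝓛₁ : ∀ {m} → ℕ → Poly (suc m) → ℤ
  𝓛₁ j P = sumℤ (map (𝓛₁-term j) P)

  𝓛≡𝓛₁-zero : ∀ {m} (P : Poly (suc m)) → 𝓛 P x ≡ 𝓛₁ 0 P
  𝓛≡𝓛₁-zero [] = refl
  𝓛≡𝓛₁-zero (t@(_ , _ ∷ _) ∷ P) = cong (λ s → 𝓛₁-term 0 t + s) (𝓛≡𝓛₁-zero P)

  𝓛₁-++ : ∀ {m} j (P R : Poly (suc m)) → 𝓛₁ j (P ++ R) ≡ 𝓛₁ j P + 𝓛₁ j R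
  𝓛₁-++ j P R = trans (cong sumℤ (map-++ (𝓛₁-term j) P R)) (sumℤ-++ (map (𝓛₁-term j) P) (map (𝓛₁-term j) R))

  𝓛₁-monomial·shift : ∀ {m} j c a b (P : Poly (suc m)) →
    𝓛₁ j (((c , a ∷ b ∷ replicate m 0) ∷ []) · shift P) ≡ c * (falling x (j ℕ.+ a) * 𝓛₁ b P)
  𝓛₁-monomial·shift j c a b [] = vanishes c (falling x (j ℕ.+ a))
    where
    vanishes : ∀ c f → + 0 ≡ c * (f * + 0)
    vanishes = solve-∀
  𝓛₁-monomial·shift {m} j c a b ((d , e₁ ∷ es) ∷ P) = begin
    c * d * (falling x (j ℕ.+ (a ℕ.+ 0)) * (falling x (b ℕ.+ e₁) * falling∏ (zipWith ℕ._+_ (replicate m 0) es)))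
      + 𝓛₁ j (((c , a ∷ b ∷ replicate m 0) ∷ []) · shift P)
      ≡⟨ cong₂ _+_
           (cong₂ (λ k fs → c * d * (falling x (j ℕ.+ k) * (falling x (b ℕ.+ e₁) * falling∏ fs)))
                  (ℕ.+-identityʳ a) (zipWith-identityˡ ℕ.+-identityˡ es))
           (𝓛₁-monomial·shift j c a b P) ⟩
    c * d * (falling x (j ℕ.+ a) * (falling x (b ℕ.+ e₁) * falling∏ es)) + c * (falling x (j ℕ.+ a) * 𝓛₁ b P)
      ≡⟨ factor-out c d (falling x (j ℕ.+ a)) (falling x (b ℕ.+ e₁) * falling∏ es) (𝓛₁ b P) ⟩
    c * (falling x (j ℕ.+ a) * (d * (falling x (b ℕ.+ e₁) * falling∏ es) + 𝓛₁ b P)) ∎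
    where
    factor-out : ∀ c d f g l → c * d * (f * g) + c * (f * l) ≡ c * (f * (d * g + l))
    factor-out = solve-∀

  𝓛₁-diffFactor·shift : ∀ {m} j (P : Poly (suc m)) →
    𝓛₁ j (diffFactor (suc m) fzero · shift P) ≡ falling x (suc j) * 𝓛₁ 0 P - falling x j * 𝓛₁ 1 P
  𝓛₁-diffFactor·shift {m} j P = begin
    𝓛₁ j ((x₁ ++ minus-x₂) · shift P)                   ≡⟨ cong (𝓛₁ j) (·-distribʳ-++ x₁ minus-x₂ (shift P)) ⟩
    𝓛₁ j (x₁ · shift P ++ minus-x₂ · shift P)           ≡⟨ 𝓛₁-++ j (x₁ · shift P) (minus-x₂ · shift P) ⟩
    𝓛₁ j (x₁ · shift P) + 𝓛₁ j (minus-x₂ · shift P)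
      ≡⟨ cong₂ _+_ (𝓛₁-monomial·shift j (+ 1) 1 0 P) (𝓛₁-monomial·shift j -[1+ 0 ] 0 1 P) ⟩
    + 1 * (falling x (j ℕ.+ 1) * 𝓛₁ 0 P) + -[1+ 0 ] * (falling x (j ℕ.+ 0) * 𝓛₁ 1 P)
      ≡⟨ cong₂ (λ k l → + 1 * (falling x k * 𝓛₁ 0 P) + -[1+ 0 ] * (falling x l * 𝓛₁ 1 P))
               (ℕ.+-comm j 1) (ℕ.+-identityʳ j) ⟩
    + 1 * (falling x (suc j) * 𝓛₁ 0 P) + -[1+ 0 ] * (falling x j * 𝓛₁ 1 P)
      ≡⟨ signed-sum (falling x (suc j) * 𝓛₁ 0 P) (falling x j * 𝓛₁ 1 P) ⟩
    falling x (suc j) * 𝓛₁ 0 P - falling x j * 𝓛₁ 1 P ∎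
    where
    x₁ minus-x₂ : Poly (suc (suc m))
    x₁ = (+ 1 , 1 ∷ 0 ∷ replicate m 0) ∷ []
    minus-x₂ = (-[1+ 0 ] , 0 ∷ 1 ∷ replicate m 0) ∷ []
    signed-sum : ∀ a b → + 1 * a + -[1+ 0 ] * b ≡ a - b
    signed-sum = solve-∀

  𝓛₁-Q-suc-suc : ∀ j m →
    𝓛₁ j (Q (suc (suc m))) ≡ falling x (suc j) * 𝓛₁ 0 (Q (suc m)) - falling x j * 𝓛₁ 1 (Q (suc m))
  𝓛₁-Q-suc-suc j m = trans (cong (𝓛₁ j) (Q-suc-suc m)) (𝓛₁-diffFactor·shift j (Q (suc m)))

  falling-1²-falling-2≡x : falling x 1 * falling x 1 - falling x 2 ≡ x
  falling-1²-falling-2≡x = begin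
    falling x 1 * falling x 1 - falling x 1 * (x - + 1) ≡⟨ cong (λ y → y * y - y * (x - + 1)) falling-1≡x ⟩
    x * x - x * (x - + 1)                               ≡⟨ x²-x[x-1]≡x x ⟩
    x                                                   ∎
    where
    falling-1≡x : falling x 1 ≡ x
    falling-1≡x = trans (ℤ.*-identityˡ (x - + 0)) (ℤ.+-identityʳ x)
    x²-x[x-1]≡x : ∀ y → y * y - y * (y - + 1) ≡ y
    x²-x[x-1]≡x = solve-∀

  𝓛₁-Q-+2 : ∀ m → 𝓛₁ 0 (Q (3 ℕ.+ m)) ≡ x * 𝓛₁ 0 (Q (suc m))
  𝓛₁-Q-+2 m = begin
    𝓛₁ 0 (Q (3 ℕ.+ m))
      ≡⟨ 𝓛₁-Q-suc-suc 0 (suc m) ⟩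
    falling x 1 * 𝓛₁ 0 (Q (2 ℕ.+ m)) - falling x 0 * 𝓛₁ 1 (Q (2 ℕ.+ m))
      ≡⟨ cong₂ (λ a b → falling x 1 * a - falling x 0 * b) (𝓛₁-Q-suc-suc 0 m) (𝓛₁-Q-suc-suc 1 m) ⟩
    falling x 1 * (falling x 1 * A - falling x 0 * B) - falling x 0 * (falling x 2 * A - falling x 1 * B)
      ≡⟨ B-terms-cancel (falling x 1) (falling x 2) A B ⟩
    (falling x 1 * falling x 1 - falling x 2) * A
      ≡⟨ cong (_* A) falling-1²-falling-2≡x ⟩
    x * A ∎
    where
    A B : ℤ
    A = 𝓛₁ 0 (Q (suc m))
    B = 𝓛₁ 1 (Q (suc m))
    B-terms-cancel : ∀ f₁ f₂ a b → f₁ * (f₁ * a - + 1 * b) - + 1 * (f₂ * a - f₁ * b) ≡ (f₁ * f₁ - f₂) * a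
    B-terms-cancel = solve-∀

  𝓛-Q-odd : ∀ k → 𝓛 (Q (suc (k ℕ.* 2))) x ≡ x ^ k
  𝓛-Q-odd k = trans (𝓛≡𝓛₁-zero (Q (suc (k ℕ.* 2)))) (𝓛₁-zero-Q-odd k)
    where
    𝓛₁-zero-Q-odd : ∀ k → 𝓛₁ 0 (Q (suc (k ℕ.* 2))) ≡ x ^ k
    𝓛₁-zero-Q-odd zero = refl
    𝓛₁-zero-Q-odd (suc k) = trans (𝓛₁-Q-+2 (k ℕ.* 2)) (cong (x *_) (𝓛₁-zero-Q-odd k))

lemma3p3 : (n : ℕ) → n % 2 ≡ 1 → 1 < n → (x : ℤ) → 𝓛 (Q n) x ≡ x ^ ((n ∸ 1) / 2)
lemma3p3 n n-odd _ x = subst (λ m → 𝓛 (Q m) x ≡ x ^ ((m ∸ 1) / 2)) (sym n≡1+k*2)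
  (trans (𝓛-Q-odd x k) (cong (x ^_) (sym (m*n/n≡m k 2))))
  where
  k : ℕ
  k = n / 2
  n≡1+k*2 : n ≡ suc (k ℕ.* 2)
  n≡1+k*2 = trans (m≡m%n+[m/n]*n n 2) (cong (ℕ._+ k ℕ.* 2) n-odd)
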